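{- Let $H$ be a grid subgraph on $c$ columns and $r$ rows (i.e. $H\subseteq G_{c\times r}$) such that $\operatorname{gr}(H,K_k)=k^{O(1)}$. Then there exist constants $\alpha,\beta,\beta'$ such that for all positive integers $k,N$ and every spanning grid subgraph $G$ of $G_{N\times N}$ with no coclique of size $k$, if $N>\alpha k^{\beta}$ then $t_g(H,G)>\alpha^{ -1}N^{r+c}k^{ -\beta'}$.
   Context: A grid subgraph on $c$ columns and $r$ rows is a graph whose vertex set is a subset of $[c]\times[r]$ (vertex $(x,y)$ in column $x$, row $y$) and whose edges each join two vertices in the same row or in the same column; $G_{c\times r}=K_c\square K_r$. A spanning grid subgraph is a spanning subgraph of $G_{N\times N}$. An embedding of $H$ (on $c_H$ columns, $r_H$ rows) into $G$ is a pair of injections $\varphi_c:[c_H]\to[c_G]$, $\varphi_r:[r_H]\to[r_G]$ sending each edge $\{(x,y),(x',y')\}$ of $H$ to an edge $\{(\varphi_c(x),\varphi_r(y)),(\varphi_c(x'),\varphi_r(y'))\}$ of $G$; $t_g(H,G)$ is the number of embeddings. A coclique of size $k$ is a set of $k$ pairwise non-adjacent vertices all in one row or all in one column. $\operatorname{gr}(H,K_k)$ is the least $N$ such that every spanning grid subgraph of $G_{N\times N}$ admits an embedding of $H$ or has a coclique of size $k$. -}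

module Defs where

open import Data.Nat using (ℕ; zero; suc)
open import Data.Bool using (Bool; true; false)
open import Data.Fin using (Fin)
open import Data.Fin.Properties using (all?) renaming (_≟_ to _≟ᶠ_)
open import Data.Bool.Properties using () renaming (_≟_ to _≟ᵇ_)
open import Data.Vec using (Vec; []; _∷_; lookup)
open import Data.List using (List; [_]; concatMap; map; allFin; filter; length; cartesianProduct)
open import Data.Product using (Σ; ∃; _×_; _,_; proj₁; proj₂)
open import Data.Sum using (_⊎_)
open import Relation.Binary.PropositionalEquality using (_≡_; _≢_)
open import Relation.Nullary using (Dec; ¬_)
open import Relation.Nullary.Decidable using (_×-dec_; _→-dec_)

-- A grid subgraph on c columns and r rows: vertex set ⊆ [c]×[r]
-- (vertex (x , y) = column x, row y), simple undirected edges, each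
-- edge joining two vertices in the same column or the same row.
record GridGraph (c r : ℕ) : Set where
  field
    vert       : Fin c → Fin r → Bool
    adj        : Fin c → Fin r → Fin c → Fin r → Bool
    adj-sym    : ∀ x y x' y' → adj x y x' y' ≡ adj x' y' x y
    adj-irrefl : ∀ x y → adj x y x y ≡ false
    adj-vert   : ∀ x y x' y' → adj x y x' y' ≡ true →
                 vert x y ≡ true × vert x' y' ≡ true
    adj-line   : ∀ x y x' y' → adj x y x' y' ≡ true → x ≡ x' ⊎ y ≡ y'

open GridGraph public

Spanning : ∀ {N} → GridGraph N N → Set
Spanning G = ∀ x y → vert G x y ≡ true

InjectiveFn : ∀ {n m} → (Fin n → Fin m) → Set
InjectiveFn f = ∀ i j → f i ≡ f j → i ≡ j

IsEmbedding : ∀ {cH rH cG rG} → GridGraph cH rH → GridGraph cG rG →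
              (Fin cH → Fin cG) → (Fin rH → Fin rG) → Set
IsEmbedding H G φc φr =
  InjectiveFn φc × InjectiveFn φr ×
  (∀ x y x' y' → adj H x y x' y' ≡ true →
     adj G (φc x) (φr y) (φc x') (φr y') ≡ true)

injective? : ∀ {n m} (f : Fin n → Fin m) → Dec (InjectiveFn f)
injective? f = all? λ i → all? λ j → (f i ≟ᶠ f j) →-dec (i ≟ᶠ j)

isEmbedding? : ∀ {cH rH cG rG} (H : GridGraph cH rH) (G : GridGraph cG rG)
               (φc : Fin cH → Fin cG) (φr : Fin rH → Fin rG) →
               Dec (IsEmbedding H G φc φr)
isEmbedding? H G φc φr =
  injective? φc ×-dec injective? φr ×-dec
  (all? λ x → all? λ y → all? λ x' → all? λ y' →
     (adj H x y x' y' ≟ᵇ true) →-dec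
     (adj G (φc x) (φr y) (φc x') (φr y') ≟ᵇ true))

allMaps : ∀ n m → List (Vec (Fin m) n)
allMaps zero    m = [ [] ]
allMaps (suc n) m = concatMap (λ i → map (i ∷_) (allMaps n m)) (allFin m)

tg : ∀ {cH rH cG rG} → GridGraph cH rH → GridGraph cG rG → ℕ
tg {cH} {rH} {cG} {rG} H G =
  length (filter (λ p → isEmbedding? H G (lookup (proj₁ p)) (lookup (proj₂ p)))
                 (cartesianProduct (allMaps cH cG) (allMaps rH rG)))

Embeds : ∀ {cH rH cG rG} → GridGraph cH rH → GridGraph cG rG → Set
Embeds H G = Σ (Fin _ → Fin _) λ φc → Σ (Fin _ → Fin _) λ φr → IsEmbedding H G φc φr

HasCoclique : ∀ {c r} → GridGraph c r → ℕ → Set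
HasCoclique {c} {r} G k =
  (Σ (Fin r) λ y → Σ (Fin k → Fin c) λ s →
     InjectiveFn s × (∀ i → vert G (s i) y ≡ true) ×
     (∀ i j → i ≢ j → adj G (s i) y (s j) y ≡ false))
  ⊎
  (Σ (Fin c) λ x → Σ (Fin k → Fin r) λ s →
     InjectiveFn s × (∀ i → vert G x (s i) ≡ true) ×
     (∀ i j → i ≢ j → adj G x (s i) x (s j) ≡ false))

-- The defining property of gr(H,K_k): every spanning grid subgraph of
-- G_{N×N} admits an embedding of H or has a coclique of size k.
GrProperty : ∀ {c r} → GridGraph c r → ℕ → ℕ → Set
GrProperty H k N = (G : GridGraph N N) → Spanning G → Embeds H G ⊎ HasCoclique G k

-- gr(H,K_k) ≤ M  (gr is the least N with GrProperty, so this holds iff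
-- some N ≤ M has the property).
GrAtMost : ∀ {c r} → GridGraph c r → ℕ → ℕ → Set
GrAtMost H k M = ∃ λ N → N Data.Nat.≤ M × GrProperty H k N

{-# OPTIONS --safe #-}
-- Let M ≥ gr(H, K) and cut the N columns and the N rows of G into M blocks of
-- L ≈ N / M consecutive lines.  Picking one column a(m) and one row b(m) in
-- every block m gives a spanning M × M subgrid of G without K-cocliques, so H
-- embeds into it and hence into G.  Such an embedding meets only c column
-- blocks and r row blocks and determines a and b there, so it arises from at
-- most L^(2M-c-r) of the L^(2M) choices of (a, b); hence t_g(H, G) ≥ L^(r+c).
-- Formally, the map sending u ∈ [L]^c, v ∈ [L]^r and (a, b) to the embedding
-- found for (a, b), together with a overwritten by u on its column blocks and
-- b overwritten by v on its row blocks, is injective.  Since M ≤ C (k + k₀)^D,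
-- this gives t_g(H, G) ≥ N^(r+c) / k^O(1).

module Submission where

open import Defs
open import Data.Nat using (ℕ; zero; suc; z≤n; s≤s; z<s; _+_; _*_; _^_; _≤_; _<_; NonZero; >-nonZero)
open import Data.Nat.Properties
  using ( ≤-trans; <⇒≤; ≤-<-trans; <-≤-trans; n≤1+n; m≤m+n; m≤n+m; m<m+n; m<n+m; m≤n*m
        ; +-monoˡ-≤; +-monoʳ-≤; *-mono-≤; *-monoˡ-≤; *-monoʳ-≤; *-monoˡ-<; *-cancelʳ-≤
        ; *-comm; *-assoc; *-suc; [m*n]*[o*p]≡[m*o]*[n*p]; m*n≢0
        ; ^-monoˡ-≤; ^-distribˡ-+-*; ^-*-assoc; m^n>0; m^n≢0; module ≤-Reasoning)
open import Data.Nat.DivMod using (_/_; _%_; m≡m%n+[m/n]*n; m%n<n; m/n*n≤m; m≥n⇒m/n>0)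
open import Data.Fin using (Fin; zero; suc; combine; inject≤)
open import Data.Fin.Properties
  using (_≟_; any?; injective⇒≤; combine-injective; inject≤-injective; 0≢1+n; suc-injective)
open import Data.Vec using (Vec; []; _∷_; lookup; map; tabulate; _[_]≔_)
open import Data.Vec.Properties
  using (lookup∘update; lookup∘update′; lookup-map; lookup∘tabulate; tabulate∘lookup; tabulate-cong; ∷-injective)
open import Data.List as List
  using (List; length; concatMap; cartesianProductWith; cartesianProduct; filter; allFin)
open import Data.List.Properties using (length-++; length-map; length-tabulate)
open import Data.List.Membership.Propositional using (_∈_)
open import Data.List.Membership.Propositional.Properties
  using (∈-lookup; ∈-allFin; ∈-filter⁺; ∈-cartesianProductWith⁺; ∈-cartesianProduct⁺)
open import Data.List.Relation.Unary.All as All using ([])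
open import Data.List.Relation.Unary.Any using (here; index)
open import Data.List.Relation.Unary.Any.Properties using (lookup-index)
open import Data.List.Relation.Unary.Unique.Propositional using (Unique)
open import Data.List.Relation.Unary.Unique.Propositional.Properties
  using (cartesianProductWith⁺; cartesianProduct⁺; allFin⁺)
open import Data.List.Relation.Unary.AllPairs using ([]; _∷_)
open import Data.Product using (∃; _×_; _,_; proj₁; proj₂)
open import Data.Sum as Sum using (inj₁; inj₂; [_,_]′)
open import Data.Empty using (⊥-elim)
open import Data.Nat.Tactic.RingSolver using (solve-∀)
open import Function using (id; _∘_)
open import Function.Definitions using (Injective)
open import Relation.Nullary using (¬_; yes; no)
open import Relation.Binary.PropositionalEquality
  using (_≡_; _≢_; _≗_; refl; sym; trans; cong; cong₂; subst; subst₂; module ≡-Reasoning)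

private variable
  A B C : Set
  m n : ℕ

Unique⇒lookup-injective : {xs : List A} → Unique xs → Injective _≡_ _≡_ (List.lookup xs)
Unique⇒lookup-injective (_    ∷ _)   {zero}  {zero}  _  = refl
Unique⇒lookup-injective (x∉xs ∷ _)   {zero}  {suc j} eq = ⊥-elim (All.lookup x∉xs (∈-lookup j) eq)
Unique⇒lookup-injective (x∉xs ∷ _)   {suc i} {zero}  eq = ⊥-elim (All.lookup x∉xs (∈-lookup i) (sym eq))
Unique⇒lookup-injective (_    ∷ xs!) {suc i} {suc j} eq = cong suc (Unique⇒lookup-injective xs! eq)

length-≤-by-injection : {xs : List A} {ys : List B} (f : A → B) → Injective _≡_ _≡_ f →
  Unique xs → (∀ {x} → x ∈ xs → f x ∈ ys) → length xs ≤ length ys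
length-≤-by-injection {xs = xs} {ys} f f-injective xs! f∈ys = injective⇒≤ g-injective
  where
  g : Fin (length xs) → Fin (length ys)
  g i = index (f∈ys (∈-lookup i))

  g-injective : Injective _≡_ _≡_ g
  g-injective {i} {j} gi≡gj = Unique⇒lookup-injective xs! (f-injective (begin
    f (List.lookup xs i)   ≡⟨ lookup-index (f∈ys (∈-lookup i)) ⟩
    List.lookup ys (g i)   ≡⟨ cong (List.lookup ys) gi≡gj ⟩
    List.lookup ys (g j)   ≡⟨ lookup-index (f∈ys (∈-lookup j)) ⟨
    f (List.lookup xs j)   ∎))
    where open ≡-Reasoning

concatMap≡cartesianProductWith : (f : A → B → C) (xs : List A) (ys : List B) →
  concatMap (λ x → List.map (f x) ys) xs ≡ cartesianProductWith f xs ys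
concatMap≡cartesianProductWith f List.[]       ys = refl
concatMap≡cartesianProductWith f (x List.∷ xs) ys =
  cong (List.map (f x) ys List.++_) (concatMap≡cartesianProductWith f xs ys)

length-cartesianProductWith : (f : A → B → C) (xs : List A) (ys : List B) →
  length (cartesianProductWith f xs ys) ≡ length xs * length ys
length-cartesianProductWith f List.[]       ys = refl
length-cartesianProductWith f (x List.∷ xs) ys = trans (length-++ (List.map (f x) ys))
  (cong₂ _+_ (length-map (f x) ys) (length-cartesianProductWith f xs ys))

length-cartesianProduct : (xs : List A) (ys : List B) → length (cartesianProduct xs ys) ≡ length xs * length ys
length-cartesianProduct = length-cartesianProductWith _,_

allMaps-suc : ∀ n m → allMaps (suc n) m ≡ cartesianProductWith _∷_ (allFin m) (allMaps n m)
allMaps-suc n m = concatMap≡cartesianProductWith _∷_ (allFin m) (allMaps n m)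

allMaps-unique : ∀ n m → Unique (allMaps n m)
allMaps-unique zero    m = [] ∷ []
allMaps-unique (suc n) m = subst Unique (sym (allMaps-suc n m))
  (cartesianProductWith⁺ _∷_ ∷-injective (allFin⁺ m) (allMaps-unique n m))

∈-allMaps : (v : Vec (Fin m) n) → v ∈ allMaps n m
∈-allMaps []      = here refl
∈-allMaps {m} {suc n} (i ∷ v) = subst (i ∷ v ∈_) (sym (allMaps-suc n m))
  (∈-cartesianProductWith⁺ _∷_ (∈-allFin i) (∈-allMaps v))

length-allMaps : ∀ n m → length (allMaps n m) ≡ m ^ n
length-allMaps zero    m = refl
length-allMaps (suc n) m = begin
  length (allMaps (suc n) m)                                   ≡⟨ cong length (allMaps-suc n m) ⟩
  length (cartesianProductWith _∷_ (allFin m) (allMaps n m))   ≡⟨ length-cartesianProductWith _∷_ (allFin m) _ ⟩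
  length (allFin m) * length (allMaps n m)                     ≡⟨ cong₂ _*_ (length-tabulate {n = m} id) (length-allMaps n m) ⟩
  m * m ^ n                                                    ∎
  where open ≡-Reasoning

≗-lookup⇒≡ : {xs ys : Vec A n} → (∀ i → lookup xs i ≡ lookup ys i) → xs ≡ ys
≗-lookup⇒≡ {xs = xs} {ys} xs≗ys = begin
  xs                   ≡⟨ tabulate∘lookup xs ⟨
  tabulate (lookup xs) ≡⟨ tabulate-cong xs≗ys ⟩
  tabulate (lookup ys) ≡⟨ tabulate∘lookup ys ⟩
  ys                   ∎
  where open ≡-Reasoning

infixl 6 _[_]≔*_

_[_]≔*_ : Vec A n → Vec (Fin n) m → Vec A m → Vec A n
a [ []    ]≔* []      = a
a [ i ∷ p ]≔* (t ∷ u) = (a [ i ]≔ t) [ p ]≔* u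

lookup∘≔*-∉ : (a : Vec A n) (p : Vec (Fin n) m) (u : Vec A m) {j : Fin n} →
  (∀ x → lookup p x ≢ j) → lookup (a [ p ]≔* u) j ≡ lookup a j
lookup∘≔*-∉ a []      []      j∉p = refl
lookup∘≔*-∉ a (i ∷ p) (t ∷ u) j∉p =
  trans (lookup∘≔*-∉ (a [ i ]≔ t) p u (j∉p ∘ suc)) (lookup∘update′ (j∉p zero ∘ sym) a t)

lookup∘≔*-∈ : (a : Vec A n) (p : Vec (Fin n) m) (u : Vec A m) → InjectiveFn (lookup p) →
  ∀ x → lookup (a [ p ]≔* u) (lookup p x) ≡ lookup u x
lookup∘≔*-∈ a (i ∷ p) (t ∷ u) p! zero =
  trans (lookup∘≔*-∉ (a [ i ]≔ t) p u (λ x eq → 0≢1+n (p! zero (suc x) (sym eq))))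
        (lookup∘update i a t)
lookup∘≔*-∈ a (i ∷ p) (t ∷ u) p! (suc x) =
  lookup∘≔*-∈ (a [ i ]≔ t) p u (λ x y → suc-injective ∘ p! (suc x) (suc y)) x

≔*-injective : {a a' : Vec A n} {p : Vec (Fin n) m} {u u' : Vec A m} → InjectiveFn (lookup p) →
  (∀ x → lookup a (lookup p x) ≡ lookup a' (lookup p x)) →
  a [ p ]≔* u ≡ a' [ p ]≔* u' → u ≡ u' × a ≡ a'
≔*-injective {a = a} {a'} {p} {u} {u'} p! a≗a'-on-p eq = ≗-lookup⇒≡ u≗u' , ≗-lookup⇒≡ a≗a'
  where
  open ≡-Reasoning
  u≗u' : ∀ x → lookup u x ≡ lookup u' x
  u≗u' x = begin
    lookup u x                          ≡⟨ lookup∘≔*-∈ a p u p! x ⟨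
    lookup (a [ p ]≔* u) (lookup p x)   ≡⟨ cong (λ v → lookup v (lookup p x)) eq ⟩
    lookup (a' [ p ]≔* u') (lookup p x) ≡⟨ lookup∘≔*-∈ a' p u' p! x ⟩
    lookup u' x                         ∎
  a≗a' : ∀ j → lookup a j ≡ lookup a' j
  a≗a' j with any? (λ x → lookup p x ≟ j)
  ... | yes (x , refl) = a≗a'-on-p x
  ... | no j∉p = begin
    lookup a j                ≡⟨ lookup∘≔*-∉ a p u (λ x e → j∉p (x , e)) ⟨
    lookup (a [ p ]≔* u) j    ≡⟨ cong (λ v → lookup v j) eq ⟩
    lookup (a' [ p ]≔* u') j  ≡⟨ lookup∘≔*-∉ a' p u' (λ x e → j∉p (x , e)) ⟩
    lookup a' j               ∎

module _ {c r c' r'} (G : GridGraph c' r') {f : Fin c → Fin c'} {g : Fin r → Fin r'}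
         (f-injective : InjectiveFn f) (g-injective : InjectiveFn g) where

  subgrid : GridGraph c r
  subgrid = record
    { vert       = λ x y → vert G (f x) (g y)
    ; adj        = λ x y x' y' → adj G (f x) (g y) (f x') (g y')
    ; adj-sym    = λ x y x' y' → adj-sym G (f x) (g y) (f x') (g y')
    ; adj-irrefl = λ x y → adj-irrefl G (f x) (g y)
    ; adj-vert   = λ x y x' y' → adj-vert G (f x) (g y) (f x') (g y')
    ; adj-line   = λ x y x' y' e →
        Sum.map (f-injective x x') (g-injective y y') (adj-line G (f x) (g y) (f x') (g y') e)
    }

  subgrid-coclique : ∀ {k} → HasCoclique subgrid k → HasCoclique G k
  subgrid-coclique (inj₁ (y , s , s! , present , independent)) =
    inj₁ (g y , f ∘ s , (λ i j → s! i j ∘ f-injective (s i) (s j)) , present , independent)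
  subgrid-coclique (inj₂ (x , s , s! , present , independent)) =
    inj₂ (f x , g ∘ s , (λ i j → s! i j ∘ g-injective (s i) (s j)) , present , independent)

  subgrid-embedding : ∀ {cH rH} {H : GridGraph cH rH} {φc φr} →
    IsEmbedding H subgrid φc φr → IsEmbedding H G (f ∘ φc) (g ∘ φr)
  subgrid-embedding (φc! , φr! , edges) =
    (λ i j → φc! i j ∘ f-injective _ _) , (λ i j → φr! i j ∘ g-injective _ _) , edges

subgrid-spanning : ∀ {N M} {G : GridGraph N N} {f g : Fin M → Fin N}
  (f! : InjectiveFn f) (g! : InjectiveFn g) → Spanning G → Spanning (subgrid G f! g!)
subgrid-spanning {f = f} {g} _ _ spanning x y = spanning (f x) (g y)

IsEmbedding-resp-≗ : ∀ {cH rH cG rG} {H : GridGraph cH rH} {G : GridGraph cG rG} {φc φc' φr φr'} →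
  φc ≗ φc' → φr ≗ φr' → IsEmbedding H G φc φr → IsEmbedding H G φc' φr'
IsEmbedding-resp-≗ {G = G} c≗ r≗ (φc! , φr! , edges) =
  (λ i j e → φc! i j (trans (c≗ i) (trans e (sym (c≗ j))))) ,
  (λ i j e → φr! i j (trans (r≗ i) (trans e (sym (r≗ j))))) ,
  λ x y x' y' e → trans (sym (adj-cong (c≗ x) (r≗ y) (c≗ x') (r≗ y'))) (edges x y x' y' e)
  where
  adj-cong : ∀ {u u' v v' w w' z z'} → u ≡ u' → v ≡ v' → w ≡ w' → z ≡ z' →
             adj G u v w z ≡ adj G u' v' w' z'
  adj-cong refl refl refl refl = refl

HasCoclique-anti-mono : ∀ {c r} {G : GridGraph c r} {k K} → k ≤ K → HasCoclique G K → HasCoclique G k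
HasCoclique-anti-mono {k = k} {K} k≤K = Sum.map
  (λ (y , s , s! , present , independent) →
     y , s ∘ ι , (λ i j → ι! i j ∘ s! _ _) , present ∘ ι , λ i j i≢j → independent _ _ (i≢j ∘ ι! i j))
  (λ (x , s , s! , present , independent) →
     x , s ∘ ι , (λ i j → ι! i j ∘ s! _ _) , present ∘ ι , λ i j i≢j → independent _ _ (i≢j ∘ ι! i j))
  where
  ι : Fin k → Fin K
  ι i = inject≤ i k≤K
  ι! : InjectiveFn ι
  ι! = inject≤-injective k≤K k≤K

module Blocks {M L N : ℕ} (ML≤N : M * L ≤ N) where

  block : Fin M → Fin L → Fin N
  block m t = inject≤ (combine m t) ML≤N

  block-injective : ∀ {m m' t t'} → block m t ≡ block m' t' → m ≡ m' × t ≡ t'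
  block-injective {m} {m'} {t} {t'} = combine-injective m t m' t' ∘ inject≤-injective ML≤N ML≤N _ _

  transversal : Vec (Fin L) M → Fin M → Fin N
  transversal a m = block m (lookup a m)

  transversal-injective : ∀ a → InjectiveFn (transversal a)
  transversal-injective a m m' = proj₁ ∘ block-injective

  trace-≔*-injective : ∀ {n} {a a' : Vec (Fin L) M} {P P' : Vec (Fin M) n} {u u' : Vec (Fin L) n} →
    InjectiveFn (lookup P) → map (transversal a) P ≡ map (transversal a') P' →
    a [ P ]≔* u ≡ a' [ P' ]≔* u' → u ≡ u' × a ≡ a'
  trace-≔*-injective {a = a} {a'} {P} {P'} {u} {u'} P! traces≡ overwrites≡ =
    ≔*-injective {p = P} P! a≗a'-on-P
      (subst (λ Q → a [ P ]≔* u ≡ a' [ Q ]≔* u') (sym P≡P') overwrites≡)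
    where
    open ≡-Reasoning
    same-block : ∀ x → lookup P x ≡ lookup P' x × lookup a (lookup P x) ≡ lookup a' (lookup P' x)
    same-block x = block-injective (begin
      transversal a (lookup P x)          ≡⟨ lookup-map x (transversal a) P ⟨
      lookup (map (transversal a) P) x    ≡⟨ cong (λ v → lookup v x) traces≡ ⟩
      lookup (map (transversal a') P') x  ≡⟨ lookup-map x (transversal a') P' ⟩
      transversal a' (lookup P' x)        ∎)
    P≡P' : P ≡ P'
    P≡P' = ≗-lookup⇒≡ (proj₁ ∘ same-block)
    a≗a'-on-P : ∀ x → lookup a (lookup P x) ≡ lookup a' (lookup P x)
    a≗a'-on-P x = trans (proj₂ (same-block x)) (cong (lookup a') (sym (proj₁ (same-block x))))

module TransversalEncoding {c r M L N K} (H : GridGraph c r) (G : GridGraph N N)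
  (G-spanning : Spanning G) (gr : GrProperty H K M) (G-K-free : ¬ HasCoclique G K) (ML≤N : M * L ≤ N) where
  open Blocks {M} {L} ML≤N

  Transversals : Set
  Transversals = Vec (Fin L) M × Vec (Fin L) M

  subgridAt : Transversals → GridGraph M M
  subgridAt (a , b) = subgrid G (transversal-injective a) (transversal-injective b)

  embeddingAt : (ab : Transversals) → Embeds H (subgridAt ab)
  embeddingAt (a , b) =
    [ id , ⊥-elim ∘ G-K-free ∘ subgrid-coclique G a! b! ]′
      (gr (subgridAt (a , b)) (subgrid-spanning {G = G} a! b! G-spanning))
    where
    a! : InjectiveFn (transversal a)
    a! = transversal-injective a
    b! : InjectiveFn (transversal b)
    b! = transversal-injective b

  columns : Transversals → Vec (Fin M) c
  columns ab = tabulate (proj₁ (embeddingAt ab))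

  rows : Transversals → Vec (Fin M) r
  rows ab = tabulate (proj₁ (proj₂ (embeddingAt ab)))

  positions-embedding : ∀ ab → IsEmbedding H (subgridAt ab) (lookup (columns ab)) (lookup (rows ab))
  positions-embedding ab =
    IsEmbedding-resp-≗ {H = H} {G = subgridAt ab}
      (λ x → sym (lookup∘tabulate φc x)) (λ y → sym (lookup∘tabulate φr y)) embedding
    where
    φc : Fin c → Fin M
    φc = proj₁ (embeddingAt ab)
    φr : Fin r → Fin M
    φr = proj₁ (proj₂ (embeddingAt ab))
    embedding : IsEmbedding H (subgridAt ab) φc φr
    embedding = proj₂ (proj₂ (embeddingAt ab))

  Embeddings : List (Vec (Fin N) c × Vec (Fin N) r)
  Embeddings = filter (λ e → isEmbedding? H G (lookup (proj₁ e)) (lookup (proj₂ e)))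
                      (cartesianProduct (allMaps c N) (allMaps r N))

  encode : (Vec (Fin L) c × Vec (Fin L) r) × Transversals →
           (Vec (Fin N) c × Vec (Fin N) r) × Transversals
  encode ((u , v) , ab@(a , b)) =
    (map (transversal a) (columns ab) , map (transversal b) (rows ab)) ,
    (a [ columns ab ]≔* u , b [ rows ab ]≔* v)

  encode-injective : Injective _≡_ _≡_ encode
  encode-injective {_ , ab} eq
    with trace-≔*-injective (proj₁ (positions-embedding ab))
                            (cong (proj₁ ∘ proj₁) eq) (cong (proj₁ ∘ proj₂) eq)
       | trace-≔*-injective (proj₁ (proj₂ (positions-embedding ab)))
                            (cong (proj₂ ∘ proj₁) eq) (cong (proj₂ ∘ proj₂) eq)
  ... | refl , refl | refl , refl = refl

  encode-∈ : ∀ x → encode x ∈ cartesianProduct Embeddings (cartesianProduct (allMaps M L) (allMaps M L))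
  encode-∈ (_ , ab@(a , b)) =
    ∈-cartesianProduct⁺
      (∈-filter⁺ _ (∈-cartesianProduct⁺ (∈-allMaps _) (∈-allMaps _)) G-embedding)
      (∈-cartesianProduct⁺ (∈-allMaps _) (∈-allMaps _))
    where
    G-embedding : IsEmbedding H G (lookup (map (transversal a) (columns ab)))
                                  (lookup (map (transversal b) (rows ab)))
    G-embedding = IsEmbedding-resp-≗ {H = H} {G = G}
      (λ x → sym (lookup-map x (transversal a) (columns ab)))
      (λ y → sym (lookup-map y (transversal b) (rows ab)))
      (subgrid-embedding G (transversal-injective a) (transversal-injective b) {H = H} (positions-embedding ab))

  length-allMaps² : ∀ m n → length (cartesianProduct (allMaps m L) (allMaps n L)) ≡ L ^ m * L ^ n
  length-allMaps² m n = trans (length-cartesianProduct (allMaps m L) (allMaps n L))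
                              (cong₂ _*_ (length-allMaps m L) (length-allMaps n L))

  counting : L ^ c * L ^ r * (L ^ M * L ^ M) ≤ tg H G * (L ^ M * L ^ M)
  counting = subst₂ _≤_
    (trans (length-cartesianProduct (cartesianProduct (allMaps c L) (allMaps r L)) _)
           (cong₂ _*_ (length-allMaps² c r) (length-allMaps² M M)))
    (trans (length-cartesianProduct Embeddings _) (cong (tg H G *_) (length-allMaps² M M)))
    (length-≤-by-injection encode encode-injective
      (cartesianProduct⁺ (cartesianProduct⁺ (allMaps-unique c L) (allMaps-unique r L))
                         (cartesianProduct⁺ (allMaps-unique M L) (allMaps-unique M L)))
      (λ {x} _ → encode-∈ x))

supersaturation : ∀ {c r M L N K} (H : GridGraph c r) (G : GridGraph N N) → Spanning G →
  GrProperty H K M → ¬ HasCoclique G K → M * L ≤ N → .{{_ : NonZero L}} → L ^ (r + c) ≤ tg H G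
supersaturation {c} {r} {M} {L} H G spanning gr K-free ML≤N = begin
  L ^ (r + c)    ≡⟨ ^-distribˡ-+-* L r c ⟩
  L ^ r * L ^ c  ≡⟨ *-comm (L ^ r) (L ^ c) ⟩
  L ^ c * L ^ r  ≤⟨ *-cancelʳ-≤ (L ^ c * L ^ r) (tg H G) (L ^ M * L ^ M) {{L²ᴹ≢0}} counting ⟩
  tg H G         ∎
  where
  open ≤-Reasoning
  open TransversalEncoding H G spanning gr K-free ML≤N
  L²ᴹ≢0 : NonZero (L ^ M * L ^ M)
  L²ᴹ≢0 = m*n≢0 (L ^ M) (L ^ M) {{m^n≢0 L M}} {{m^n≢0 L M}}

^-distribʳ-* : ∀ m n o → (m * n) ^ o ≡ m ^ o * n ^ o
^-distribʳ-* m n zero    = refl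
^-distribʳ-* m n (suc o) =
  trans (cong (m * n *_) (^-distribʳ-* m n o)) ([m*n]*[o*p]≡[m*o]*[n*p] m n (m ^ o) (n ^ o))

n≤2*m*[n/m] : ∀ m n .{{_ : NonZero m}} → m ≤ n → n ≤ 2 * m * (n / m)
n≤2*m*[n/m] m n m≤n = begin
  n                      ≡⟨ m≡m%n+[m/n]*n n m ⟩
  n % m + n / m * m      ≤⟨ +-monoˡ-≤ (n / m * m) (<⇒≤ (m%n<n n m)) ⟩
  m + n / m * m          ≤⟨ +-monoˡ-≤ (n / m * m) (m≤n*m m (n / m) {{>-nonZero (m≥n⇒m/n>0 m≤n)}}) ⟩
  n / m * m + n / m * m  ≡⟨ double (n / m) m ⟩
  2 * m * (n / m)        ∎
  where
  open ≤-Reasoning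
  double : ∀ x y → x * y + x * y ≡ 2 * y * x
  double = solve-∀

shifted-power-< : ∀ C D k₀ k .{{_ : NonZero k}} → C * (k + k₀) ^ D < suc (C * suc k₀ ^ D) * k ^ D
shifted-power-< C D k₀ k = begin-strict
  C * (k + k₀) ^ D           ≤⟨ *-monoʳ-≤ C (^-monoˡ-≤ D k+k₀≤k*[1+k₀]) ⟩
  C * (k * suc k₀) ^ D       ≡⟨ cong (C *_) (^-distribʳ-* k (suc k₀) D) ⟩
  C * (k ^ D * suc k₀ ^ D)   ≡⟨ cong (C *_) (*-comm (k ^ D) (suc k₀ ^ D)) ⟩
  C * (suc k₀ ^ D * k ^ D)   ≡⟨ *-assoc C (suc k₀ ^ D) (k ^ D) ⟨
  C * suc k₀ ^ D * k ^ D     <⟨ m<n+m (C * suc k₀ ^ D * k ^ D) (m^n>0 k D) ⟩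
  suc (C * suc k₀ ^ D) * k ^ D ∎
  where
  open ≤-Reasoning
  k+k₀≤k*[1+k₀] : k + k₀ ≤ k * suc k₀
  k+k₀≤k*[1+k₀] = subst (k + k₀ ≤_) (sym (*-suc k k₀)) (+-monoʳ-≤ k (m≤n*m k₀ k))

[m*n^d]^s≡m^s*n^[d*s] : ∀ m n d s → (m * n ^ d) ^ s ≡ m ^ s * n ^ (d * s)
[m*n^d]^s≡m^s*n^[d*s] m n d s =
  trans (^-distribʳ-* m (n ^ d) s) (cong (m ^ s *_) (^-*-assoc n d s))

GrAtMost⇒tg-bound : ∀ {c r K B N} (H : GridGraph c r) (G : GridGraph N N) → Spanning G →
  ¬ HasCoclique G K → GrAtMost H K B → B < N →
  0 < tg H G × N ^ (r + c) ≤ (2 * suc B) ^ (r + c) * tg H G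
GrAtMost⇒tg-bound {c} {r} {B = B} {N} H G spanning K-free (N₀ , N₀≤B , gr) B<N =
  <-≤-trans (m^n>0 L (r + c)) Lʳ⁺ᶜ≤tg , (begin
    N ^ (r + c)                            ≤⟨ ^-monoˡ-≤ (r + c) (n≤2*m*[n/m] (suc N₀) N N₀<N) ⟩
    (2 * suc N₀ * L) ^ (r + c)             ≡⟨ ^-distribʳ-* (2 * suc N₀) L (r + c) ⟩
    (2 * suc N₀) ^ (r + c) * L ^ (r + c)   ≤⟨ *-mono-≤ (^-monoˡ-≤ (r + c) (*-monoʳ-≤ 2 (s≤s N₀≤B))) Lʳ⁺ᶜ≤tg ⟩
    (2 * suc B) ^ (r + c) * tg H G         ∎)
  where
  open ≤-Reasoning
  N₀<N : N₀ < N
  N₀<N = ≤-<-trans N₀≤B B<N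
  -- Dividing by N₀ + 1 rather than N₀ avoids the case N₀ = 0 (possible when c = r = 0).
  L : ℕ
  L = N / suc N₀
  instance L≢0 : NonZero L
  L≢0 = >-nonZero (m≥n⇒m/n>0 N₀<N)
  Lʳ⁺ᶜ≤tg : L ^ (r + c) ≤ tg H G
  Lʳ⁺ᶜ≤tg = supersaturation H G spanning gr K-free
    (≤-trans (*-monoˡ-≤ L (n≤1+n N₀)) (subst (_≤ N) (*-comm L (suc N₀)) (m/n*n≤m N (suc N₀))))

proposition3p4 : ∀ {c r} (H : GridGraph c r) →
    (∃ λ C → ∃ λ D → ∃ λ k₀ → ∀ k → 1 ≤ k → k₀ ≤ k → GrAtMost H k (C * k ^ D)) →
    ∃ λ α → ∃ λ β → ∃ λ β' →
      ∀ (k N : ℕ) → 1 ≤ k → 1 ≤ N →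
      (G : GridGraph N N) → Spanning G → ¬ HasCoclique G k →
      α * k ^ β < N →
      N ^ (r + c) < α * k ^ β' * tg H G
proposition3p4 {c} {r} H (C , D , k₀ , gr≤) = (2 * Q) ^ s + Q , D , D * s , bound
  where
  s Q : ℕ
  s = r + c
  Q = suc (C * suc k₀ ^ D)
  bound : ∀ k N → 1 ≤ k → 1 ≤ N → (G : GridGraph N N) → Spanning G → ¬ HasCoclique G k →
    ((2 * Q) ^ s + Q) * k ^ D < N → N ^ s < ((2 * Q) ^ s + Q) * k ^ (D * s) * tg H G
  bound k@(suc _) N _ _ G spanning k-free threshold = begin-strict
    N ^ s                                     ≤⟨ proj₂ tg-bound ⟩
    (2 * suc M) ^ s * tg H G                  ≤⟨ *-monoˡ-≤ (tg H G) (^-monoˡ-≤ s (*-monoʳ-≤ 2 M<Qkᴰ)) ⟩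
    (2 * (Q * k ^ D)) ^ s * tg H G            ≡⟨ cong (λ x → x ^ s * tg H G) (*-assoc 2 Q (k ^ D)) ⟨
    (2 * Q * k ^ D) ^ s * tg H G              ≡⟨ cong (_* tg H G) ([m*n^d]^s≡m^s*n^[d*s] (2 * Q) k D s) ⟩
    (2 * Q) ^ s * k ^ (D * s) * tg H G        <⟨ *-monoˡ-< (tg H G) {{>-nonZero (proj₁ tg-bound)}}
                                                   (*-monoˡ-< (k ^ (D * s)) {{m^n≢0 k (D * s)}} (m<m+n ((2 * Q) ^ s) z<s)) ⟩
    ((2 * Q) ^ s + Q) * k ^ (D * s) * tg H G  ∎
    where
    open ≤-Reasoning
    M : ℕ
    M = C * (k + k₀) ^ D
    M<Qkᴰ : M < Q * k ^ D
    M<Qkᴰ = shifted-power-< C D k₀ k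
    -- The hypothesis only covers k ≥ k₀, so it is used at K = k + k₀.
    tg-bound : 0 < tg H G × N ^ s ≤ (2 * suc M) ^ s * tg H G
    tg-bound = GrAtMost⇒tg-bound H G spanning (k-free ∘ HasCoclique-anti-mono {G = G} (m≤m+n k k₀))
      (gr≤ (k + k₀) (s≤s z≤n) (m≤n+m k₀ k))
      (<-≤-trans M<Qkᴰ (≤-trans (*-monoˡ-≤ (k ^ D) (m≤n+m Q ((2 * Q) ^ s))) (<⇒≤ threshold)))
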